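{- Let $n\ge 3$ be an integer and let $f(n)=0$ if the Sharing Nim position $(0,0,n)$ is a $\mathcal{P}$-position and $f(n)=1$ otherwise. Then: (1) if $n$ is odd, $f(n)=0$; (2) if $n \bmod 32\in\{4,12,16,20,28\}$, then $f(n)=0$; (3) if $n\bmod 32\in\{2,6,8,10,14,18,22,24,26,30\}$, then $f(n)=1$.
   Context: Three-pile Sharing Nim: a position is a triple of nonnegative integers (pile sizes; order irrelevant). A move takes some positive number $k$ of tokens from one pile and adds them to another pile, provided that after the move the receiving pile does not have more tokens than the source pile; i.e. from $(a,b,c)$ with $a\le b\le c$ one may move to $(a+k,b-k,c)$ with $1\le k\le (b-a)/2$, to $(a+k,b,c-k)$ with $1\le k\le (c-a)/2$, or to $(a,b+k,c-k)$ with $1\le k\le (c-b)/2$. Normal play. A $\mathcal{P}$-position is one from which the player about to move has no winning strategy. -}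

module Defs where

open import Data.Nat using (ℕ; _+_; _≤_)
open import Data.Product using (_×_; _,_)
open import Relation.Nullary using (¬_)

-- A position: three piles (order irrelevant; moves below are symmetric
-- under permutations of the piles).
Pos : Set
Pos = ℕ × ℕ × ℕ

-- A move takes k ≥ 1 tokens from a source pile (holding k + s) and adds
-- them to a receiving pile r, provided afterwards the receiving pile
-- (r + k) does not exceed the source pile (s).
data Move : Pos → Pos → Set where
  m01 : ∀ {k s r z} → 1 ≤ k → r + k ≤ s → Move (k + s , r , z) (s , r + k , z)
  m02 : ∀ {k s r y} → 1 ≤ k → r + k ≤ s → Move (k + s , y , r) (s , y , r + k)
  m10 : ∀ {k s r z} → 1 ≤ k → r + k ≤ s → Move (r , k + s , z) (r + k , s , z)
  m12 : ∀ {k s r x} → 1 ≤ k → r + k ≤ s → Move (x , k + s , r) (x , s , r + k)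
  m20 : ∀ {k s r y} → 1 ≤ k → r + k ≤ s → Move (r , y , k + s) (r + k , y , s)
  m21 : ∀ {k s r x} → 1 ≤ k → r + k ≤ s → Move (x , r , k + s) (x , r + k , s)

-- Win p : the player about to move from p has a winning strategy
-- (normal play): some move leads to a position from which every reply
-- again leaves a winning position for us.
data Win : Pos → Set where
  win : ∀ {p q} → Move p q → (∀ r → Move q r → Win r) → Win p

IsP : Pos → Set
IsP p = ¬ Win p

-- Call a number good if it is 0 or its 2-adic valuation is even.  The
-- P-positions are exactly the triples in which two piles are equal and the
-- third differs from them by a good number.  A move between two such
-- triples would have to create gaps k and 2k with k > 0, which are never both
-- good; conversely, from any other triple, moving tokens from the largest to
-- the smallest pile reaches one.  Every move lowers the sum of the squares of
-- the piles, so play is finite.  The theorem then reads off the residues: odd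
-- n and n ≡ 4, 12, 16, 20, 28 (mod 32) are good, the other even residues are
-- twice a good number.
module Submission where

open import Defs
open import Data.Nat
  using (ℕ; zero; suc; _+_; _*_; _^_; _≤_; _<_; z≤n; s≤s; z<s; _%_; _/_; ∣_-_∣; NonZero)
open import Data.Nat.Properties
open import Algebra.Properties.CommutativeSemigroup +-commutativeSemigroup using (xy∙z≈xz∙y)
open import Data.Nat.DivMod using (m≡m%n+[m/n]*n; m%n<n)
open import Data.Nat.Divisibility using (_∣_; ∣m+n∣m⇒∣n; ∣1⇒≡1; m∣m*n)
open import Data.Nat.Induction using (<-wellFounded)
open import Data.Nat.Tactic.RingSolver using (solve)
open import Induction.WellFounded using (Acc; acc)
open import Data.Product using (_×_; _,_; ∃-syntax)
import Data.Product as Product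
open import Data.Sum using (_⊎_; inj₁; inj₂)
import Data.Sum as Sum
open import Data.Empty using (⊥-elim)
open import Data.List using (_∷_; [])
open import Data.List.Membership.Propositional using (_∈_)
open import Data.List.Relation.Unary.All using (All; lookup)
open import Relation.Binary.PropositionalEquality
open import Relation.Nullary using (¬_)

data Good : ℕ → Set where
  zero      : Good 0
  odd       : ∀ m → Good (suc (2 * m))
  quadruple : ∀ {n} → Good n → Good (4 * n)

data Bad : ℕ → Set where
  double : ∀ {h} → Good (suc h) → Bad (2 * suc h)

odd≢even : ∀ m n → suc (2 * m) ≢ 2 * n
odd≢even m n eq = 1+n≢n (∣1⇒≡1 (∣m+n∣m⇒∣n 2∣2m+1 (m∣m*n m)))
  where
  2∣2m+1 : 2 ∣ 2 * m + 1
  2∣2m+1 = subst (2 ∣_) (trans (sym eq) (+-comm 1 (2 * m))) (m∣m*n n)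

4*n≡2*k⇒2*n≡k : ∀ {n k} → 4 * n ≡ 2 * k → 2 * n ≡ k
4*n≡2*k⇒2*n≡k {n} {k} eq = *-cancelˡ-≡ (2 * n) k 2 (trans (sym (*-assoc 2 2 n)) eq)

good-double⇒zero : ∀ {k m} → Good k → Good m → m ≡ 2 * k → k ≡ 0
good-double⇒zero {k} _ zero eq = *-cancelˡ-≡ k 0 2 (sym eq)
good-double⇒zero {k} _ (odd j) eq = ⊥-elim (odd≢even j k eq)
good-double⇒zero zero (quadruple _) _ = refl
good-double⇒zero (odd i) (quadruple {n} _) eq = ⊥-elim (odd≢even i n (sym (4*n≡2*k⇒2*n≡k {n} eq)))
good-double⇒zero (quadruple {p} gp) (quadruple {n} gn) eq =
  cong (4 *_) (good-double⇒zero gp gn (sym (4*n≡2*k⇒2*n≡k {p} (sym (4*n≡2*k⇒2*n≡k {n} eq)))))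

good⇒¬good-double : ∀ {k} → 0 < k → Good k → ¬ Good (2 * k)
good⇒¬good-double k>0 gk g2k = <-irrefl (sym (good-double⇒zero gk g2k refl)) k>0

even-or-odd : ∀ n → (∃[ m ] n ≡ 2 * m) ⊎ (∃[ m ] n ≡ suc (2 * m))
even-or-odd zero = inj₁ (0 , refl)
even-or-odd (suc n) with even-or-odd n
... | inj₁ (m , refl) = inj₂ (m , refl)
... | inj₂ (m , refl) = inj₁ (suc m , sym (*-distribˡ-+ 2 1 m))

good-or-bad : ∀ n → Good n ⊎ Bad n
good-or-bad n = go n (<-wellFounded n)
  where
  go : ∀ n → Acc _<_ n → Good n ⊎ Bad n
  go n (acc rec) with even-or-odd n
  ... | inj₂ (m , refl) = inj₁ (odd m)
  ... | inj₁ (zero , refl) = inj₁ zero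
  ... | inj₁ (suc m , refl) with go (suc m) (rec (m<m+n (suc m) z<s))
  ...   | inj₁ g = inj₂ (double g)
  ...   | inj₂ (double {h} g) = inj₁ (subst Good (*-assoc 2 2 (suc h)) (quadruple g))

good-periodic : ∀ {r} j q → Good r → 0 < r → r < 2 ^ j → Good (r + q * 2 ^ j)
good-periodic _ _ zero () _
good-periodic zero _ (odd _) _ (s≤s ())
good-periodic (suc j) q (odd m) _ _ = subst Good (cong suc (shift (2 ^ j))) (odd (m + q * 2 ^ j))
  where
  shift : ∀ x → 2 * (m + q * x) ≡ 2 * m + q * (2 * x)
  shift x = solve (m ∷ q ∷ x ∷ [])
good-periodic _ _ (quadruple {zero} _) () _
good-periodic zero _ (quadruple {suc _} _) _ (s≤s ())
good-periodic (suc zero) _ (quadruple {suc n} _) _ r<2 =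
  ⊥-elim (<⇒≱ r<2 (≤-trans (m≤m+n 2 2) (*-monoʳ-≤ 4 (s≤s {n = n} z≤n))))
good-periodic (suc (suc j)) q (quadruple {suc n} g) _ r<2^j+2 =
  subst Good (shift (2 ^ j)) (quadruple (good-periodic j q g z<s n<2^j))
  where
  n<2^j : suc n < 2 ^ j
  n<2^j = *-cancelˡ-< 4 (suc n) (2 ^ j) (subst (4 * suc n <_) (sym (*-assoc 2 2 (2 ^ j))) r<2^j+2)
  shift : ∀ x → 4 * (suc n + q * x) ≡ 4 * suc n + q * (2 * (2 * x))
  shift x = solve (n ∷ q ∷ x ∷ [])

bad-periodic : ∀ {r} j q → Bad r → r < 2 ^ suc j → Bad (r + q * 2 ^ suc j)
bad-periodic j q (double {h} g) r<2^j+1 =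
  subst Bad (shift (2 ^ j)) (double (good-periodic j q g z<s (*-cancelˡ-< 2 (suc h) (2 ^ j) r<2^j+1)))
  where
  shift : ∀ x → 2 * (suc h + q * x) ≡ 2 * suc h + q * (2 * x)
  shift x = solve (h ∷ q ∷ x ∷ [])

good-from-residue : ∀ j n .{{_ : NonZero (2 ^ j)}} → Good (n % 2 ^ j) × 0 < n % 2 ^ j → Good n
good-from-residue j n (g , r>0) =
  subst Good (sym (m≡m%n+[m/n]*n n (2 ^ j))) (good-periodic j (n / 2 ^ j) g r>0 (m%n<n n (2 ^ j)))

bad-from-residue : ∀ j n .{{_ : NonZero (2 ^ suc j)}} → Bad (n % 2 ^ suc j) → Bad n
bad-from-residue j n b =
  subst Bad (sym (m≡m%n+[m/n]*n n (2 ^ suc j))) (bad-periodic j (n / 2 ^ suc j) b (m%n<n n (2 ^ suc j)))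

data PPos : Pos → Set where
  pair₀₁ : ∀ {x y z} → x ≡ y → Good ∣ x - z ∣ → PPos (x , y , z)
  pair₁₂ : ∀ {x y z} → y ≡ z → Good ∣ y - x ∣ → PPos (x , y , z)
  pair₀₂ : ∀ {x y z} → x ≡ z → Good ∣ x - y ∣ → PPos (x , y , z)

m+n≡o⇒∣m-o∣≡n : ∀ {m n o} → m + n ≡ o → ∣ m - o ∣ ≡ n
m+n≡o⇒∣m-o∣≡n {m} {n} refl = ∣m-m+n∣≡n m n

m+n≡o⇒∣o-m∣≡n : ∀ {m n o} → m + n ≡ o → ∣ o - m ∣ ≡ n
m+n≡o⇒∣o-m∣≡n {m} {n} {o} eq = trans (∣-∣-comm o m) (m+n≡o⇒∣m-o∣≡n eq)

swap₀₁ : Pos → Pos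
swap₀₁ (x , y , z) = (y , x , z)

swap₁₂ : Pos → Pos
swap₁₂ (x , y , z) = (x , z , y)

PPos-swap₀₁ : ∀ {p} → PPos p → PPos (swap₀₁ p)
PPos-swap₀₁ (pair₀₁ refl g) = pair₀₁ refl g
PPos-swap₀₁ (pair₁₂ eq g) = pair₀₂ eq g
PPos-swap₀₁ (pair₀₂ eq g) = pair₁₂ eq g

PPos-swap₁₂ : ∀ {p} → PPos p → PPos (swap₁₂ p)
PPos-swap₁₂ (pair₀₁ eq g) = pair₀₂ eq g
PPos-swap₁₂ (pair₁₂ refl g) = pair₁₂ refl g
PPos-swap₁₂ (pair₀₂ eq g) = pair₀₁ eq g

Move-swap₀₁ : ∀ {p q} → Move p q → Move (swap₀₁ p) (swap₀₁ q)
Move-swap₀₁ (m01 k>0 r+k≤s) = m10 k>0 r+k≤s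
Move-swap₀₁ (m02 k>0 r+k≤s) = m12 k>0 r+k≤s
Move-swap₀₁ (m10 k>0 r+k≤s) = m01 k>0 r+k≤s
Move-swap₀₁ (m12 k>0 r+k≤s) = m02 k>0 r+k≤s
Move-swap₀₁ (m20 k>0 r+k≤s) = m21 k>0 r+k≤s
Move-swap₀₁ (m21 k>0 r+k≤s) = m20 k>0 r+k≤s

Move-swap₁₂ : ∀ {p q} → Move p q → Move (swap₁₂ p) (swap₁₂ q)
Move-swap₁₂ (m01 k>0 r+k≤s) = m02 k>0 r+k≤s
Move-swap₁₂ (m02 k>0 r+k≤s) = m01 k>0 r+k≤s
Move-swap₁₂ (m10 k>0 r+k≤s) = m20 k>0 r+k≤s
Move-swap₁₂ (m12 k>0 r+k≤s) = m21 k>0 r+k≤s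
Move-swap₁₂ (m20 k>0 r+k≤s) = m10 k>0 r+k≤s
Move-swap₁₂ (m21 k>0 r+k≤s) = m12 k>0 r+k≤s

Move-elim : (R : Pos → Pos → Set) →
            (∀ {p q} → R p q → R (swap₀₁ p) (swap₀₁ q)) →
            (∀ {p q} → R p q → R (swap₁₂ p) (swap₁₂ q)) →
            (∀ {k s r z} → 0 < k → r + k ≤ s → R (k + s , r , z) (s , r + k , z)) →
            ∀ {p q} → Move p q → R p q
Move-elim R s₀₁ s₁₂ step (m01 k>0 r+k≤s) = step k>0 r+k≤s
Move-elim R s₀₁ s₁₂ step (m02 k>0 r+k≤s) = s₁₂ (step k>0 r+k≤s)
Move-elim R s₀₁ s₁₂ step (m10 k>0 r+k≤s) = s₀₁ (step k>0 r+k≤s)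
Move-elim R s₀₁ s₁₂ step (m12 k>0 r+k≤s) = s₀₁ (s₁₂ (step k>0 r+k≤s))
Move-elim R s₀₁ s₁₂ step (m20 k>0 r+k≤s) = s₁₂ (s₀₁ (step k>0 r+k≤s))
Move-elim R s₀₁ s₁₂ step (m21 k>0 r+k≤s) = s₁₂ (s₀₁ (s₁₂ (step k>0 r+k≤s)))

-- The only moves joining two candidate positions would leave gaps k and 2 * k.
PPos-step : ∀ {k s r z} → 0 < k → r + k ≤ s → PPos (k + s , r , z) → ¬ PPos (s , r + k , z)
PPos-step {k} {s} {r} k>0 r+k≤s (pair₀₁ eq _) _ =
  <-irrefl (sym eq) (<-≤-trans (<-≤-trans (m<m+n r k>0) r+k≤s) (m≤n+m s k))
PPos-step {k} {r = r} k>0 _ (pair₁₂ refl g) (pair₀₁ refl g') =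
  good⇒¬good-double k>0 (subst Good (m+n≡o⇒∣o-m∣≡n {r} refl) g')
                        (subst Good (m+n≡o⇒∣m-o∣≡n {r} {2 * k} {k + (r + k)} (solve (r ∷ k ∷ []))) g)
PPos-step k>0 _ (pair₁₂ refl _) (pair₁₂ eq _) = <-irrefl (sym eq) (m<m+n _ k>0)
PPos-step {r = r} k>0 r+k≤s (pair₁₂ refl _) (pair₀₂ eq _) =
  <-irrefl (sym eq) (<-≤-trans (m<m+n r k>0) r+k≤s)
PPos-step {k} {r = r} k>0 _ (pair₀₂ refl g) (pair₀₁ refl g') =
  good⇒¬good-double k>0 (subst Good (m+n≡o⇒∣m-o∣≡n (+-comm (r + k) k)) g')
                        (subst Good (m+n≡o⇒∣o-m∣≡n {r} {2 * k} {k + (r + k)} (solve (r ∷ k ∷ []))) g)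
PPos-step {s = s} k>0 r+k≤s (pair₀₂ refl _) (pair₁₂ eq _) =
  <-irrefl eq (≤-<-trans r+k≤s (m<n+m s k>0))
PPos-step {s = s} k>0 _ (pair₀₂ refl _) (pair₀₂ eq _) = <-irrefl eq (m<n+m s k>0)

no-move-between-PPos : ∀ {p q} → Move p q → PPos p → ¬ PPos q
no-move-between-PPos = Move-elim (λ p q → PPos p → ¬ PPos q)
  (λ h Pp Pq → h (PPos-swap₀₁ Pp) (PPos-swap₀₁ Pq))
  (λ h Pp Pq → h (PPos-swap₁₂ Pp) (PPos-swap₁₂ Pq))
  PPos-step

squareSum : Pos → ℕ
squareSum (x , y , z) = x * x + y * y + z * z

squareSum-swap₀₁ : ∀ p → squareSum (swap₀₁ p) ≡ squareSum p
squareSum-swap₀₁ (x , y , z) = cong (_+ z * z) (+-comm (y * y) (x * x))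

squareSum-swap₁₂ : ∀ p → squareSum (swap₁₂ p) ≡ squareSum p
squareSum-swap₁₂ (x , y , z) = xy∙z≈xz∙y (x * x) (z * z) (y * y)

-- With s = r + k + e the transfer lowers the sum of squares by 2 k (k + e).
squareSum-step : ∀ {k s r z} → 0 < k → r + k ≤ s → squareSum (s , r + k , z) < squareSum (k + s , r , z)
squareSum-step {suc k} {r = r} {z} _ r+k≤s with m≤n⇒∃[o]m+o≡n r+k≤s
... | e , refl = +-monoˡ-< (z * z) (subst (after <_) (sym expand) (m<m+n after z<s))
  where
  after : ℕ
  after = (r + suc k + e) * (r + suc k + e) + (r + suc k) * (r + suc k)
  expand : (suc k + (r + suc k + e)) * (suc k + (r + suc k + e)) + r * r
         ≡ (r + suc k + e) * (r + suc k + e) + (r + suc k) * (r + suc k) + 2 * suc k * (suc k + e)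
  expand = solve (k ∷ r ∷ e ∷ [])

squareSum-decreasing : ∀ {p q} → Move p q → squareSum q < squareSum p
squareSum-decreasing = Move-elim (λ p q → squareSum q < squareSum p)
  (λ {p} {q} h → subst₂ _<_ (sym (squareSum-swap₀₁ q)) (sym (squareSum-swap₀₁ p)) h)
  (λ {p} {q} h → subst₂ _<_ (sym (squareSum-swap₁₂ q)) (sym (squareSum-swap₁₂ p)) h)
  (λ {k} {s} {r} {z} → squareSum-step {k} {s} {r} {z})

WithinOneMoveOfP : Pos → Set
WithinOneMoveOfP p = PPos p ⊎ ∃[ q ] Move p q × PPos q

good-∣m-o∣ : ∀ m o {n} → Good n → m + n ≡ o → Good ∣ m - o ∣
good-∣m-o∣ _ _ g eq = subst Good (sym (m+n≡o⇒∣m-o∣≡n eq)) g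

good-∣o-m∣ : ∀ m o {n} → Good n → m + n ≡ o → Good ∣ o - m ∣
good-∣o-m∣ _ _ g eq = subst Good (sym (m+n≡o⇒∣o-m∣≡n eq)) g

move₂₀ : ∀ {a b c} k s → c ≡ k + s → 0 < k → a + k ≤ s → Move (a , b , c) (a + k , b , s)
move₂₀ k s refl = m20

-- Piles a ≤ b ≤ c whose gaps b - a ≤ c - b differ by g: move tokens from c to
-- a so as to equalise a and b if g is good, a and c if g = 2 h.
reach-lower : ∀ a x g → Good g ⊎ Bad g → WithinOneMoveOfP (a , a + x , a + x + (x + g))
reach-lower a zero g (inj₁ gg) =
  inj₁ (pair₀₁ (sym (+-identityʳ a)) (good-∣m-o∣ a _ gg (cong (_+ g) (sym (+-identityʳ a)))))
reach-lower a (suc x) g (inj₁ gg) =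
  inj₂ (_ , move₂₀ (suc x) (a + suc x + g) (solve (a ∷ x ∷ g ∷ [])) z<s (m≤m+n _ g)
          , pair₀₁ refl (good-∣m-o∣ (a + suc x) _ gg refl))
reach-lower a x _ (inj₂ (double {h} gh)) =
  inj₂ (_ , move₂₀ (x + suc h) (a + x + suc h) (solve (a ∷ x ∷ h ∷ []))
                   (<-≤-trans z<s (m≤n+m (suc h) x)) (≤-reflexive (sym (+-assoc a x (suc h))))
          , pair₀₂ (sym (+-assoc a x (suc h))) (good-∣o-m∣ (a + x) _ gh (+-assoc a x (suc h))))

-- As above with b - a ≥ c - b: equalise b and c if g is good, a and c if g = 2 h.
reach-upper : ∀ a y g → Good g ⊎ Bad g → WithinOneMoveOfP (a , a + (y + g) , a + (y + g) + y)
reach-upper a zero g (inj₁ gg) = inj₁ (pair₁₂ (sym (+-identityʳ _)) (good-∣o-m∣ a _ gg refl))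
reach-upper a (suc y) g (inj₁ gg) =
  inj₂ (_ , move₂₀ (suc y) (a + (suc y + g)) (+-comm _ (suc y)) z<s (+-monoʳ-≤ a (m≤m+n (suc y) g))
          , pair₁₂ refl (good-∣o-m∣ (a + suc y) _ gg (+-assoc a (suc y) g)))
reach-upper a y _ (inj₂ (double {h} gh)) =
  inj₂ (_ , move₂₀ (y + suc h) (a + y + suc h) (solve (a ∷ y ∷ h ∷ []))
                   (<-≤-trans z<s (m≤n+m (suc h) y)) (≤-reflexive (sym (+-assoc a y (suc h))))
          , pair₀₂ (sym (+-assoc a y (suc h))) (good-∣m-o∣ (a + (y + suc h)) (a + (y + 2 * suc h)) gh
                                                        (solve (a ∷ y ∷ h ∷ []))))

reach-PPos-sorted : ∀ a x y → WithinOneMoveOfP (a , a + x , a + x + y)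
reach-PPos-sorted a x y with ≤-total x y
... | inj₁ x≤y with m≤n⇒∃[o]m+o≡n x≤y
...   | g , refl = reach-lower a x g (good-or-bad g)
reach-PPos-sorted a x y | inj₂ y≤x with m≤n⇒∃[o]m+o≡n y≤x
...   | g , refl = reach-upper a y g (good-or-bad g)

sorted-elim : (P : Pos → Set) → (∀ a x y → P (a , a + x , a + x + y)) →
              ∀ {u v w} → u ≤ v → v ≤ w → P (u , v , w)
sorted-elim P base {u} u≤v v≤w with m≤n⇒∃[o]m+o≡n u≤v | m≤n⇒∃[o]m+o≡n v≤w
... | d , refl | e , refl = base u d e

sort-elim : (P : Pos → Set) →
            (∀ {p} → P p → P (swap₀₁ p)) →
            (∀ {p} → P p → P (swap₁₂ p)) →
            (∀ a x y → P (a , a + x , a + x + y)) →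
            ∀ p → P p
sort-elim P s₀₁ s₁₂ base (x , y , z) with ≤-total x y | ≤-total y z | ≤-total x z
... | inj₁ x≤y | inj₁ y≤z | _        = sorted-elim P base x≤y y≤z
... | inj₁ x≤y | inj₂ z≤y | inj₁ x≤z = s₁₂ (sorted-elim P base x≤z z≤y)
... | inj₁ x≤y | inj₂ z≤y | inj₂ z≤x = s₁₂ (s₀₁ (sorted-elim P base z≤x x≤y))
... | inj₂ y≤x | _        | inj₁ x≤z = s₀₁ (sorted-elim P base y≤x x≤z)
... | inj₂ y≤x | inj₁ y≤z | inj₂ z≤x = s₀₁ (s₁₂ (sorted-elim P base y≤z z≤x))
... | inj₂ y≤x | inj₂ z≤y | inj₂ z≤x = s₀₁ (s₁₂ (s₀₁ (sorted-elim P base z≤y y≤x)))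

reach-PPos : ∀ p → WithinOneMoveOfP p
reach-PPos = sort-elim WithinOneMoveOfP
  (Sum.map PPos-swap₀₁ (Product.map swap₀₁ (Product.map Move-swap₀₁ PPos-swap₀₁)))
  (Sum.map PPos-swap₁₂ (Product.map swap₁₂ (Product.map Move-swap₁₂ PPos-swap₁₂)))
  reach-PPos-sorted

PPos⇒IsP : ∀ {p} → PPos p → IsP p
PPos⇒IsP Pp (win {q = q} p→q q-wins) with reach-PPos q
... | inj₁ Pq = no-move-between-PPos p→q Pp Pq
... | inj₂ (r , q→r , Pr) = PPos⇒IsP Pr (q-wins r q→r)

¬PPos⇒Win : ∀ {p} → ¬ PPos p → Win p
¬PPos⇒Win {p} = go p (<-wellFounded (squareSum p))
  where
  go : ∀ p → Acc _<_ (squareSum p) → ¬ PPos p → Win p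
  go p (acc rec) ¬Pp with reach-PPos p
  ... | inj₁ Pp = ⊥-elim (¬Pp Pp)
  ... | inj₂ (q , p→q , Pq) = win p→q λ r q→r →
    go r (rec (<-trans (squareSum-decreasing q→r) (squareSum-decreasing p→q)))
         (no-move-between-PPos q→r Pq)

bad⇒¬PPos : ∀ {n} → Bad n → ¬ PPos (0 , 0 , n)
bad⇒¬PPos (double g) (pair₀₁ _ g2) = good⇒¬good-double z<s g g2
bad⇒¬PPos (double _) (pair₁₂ () _)
bad⇒¬PPos (double _) (pair₀₂ () _)

good-residues : All (λ r → Good r × 0 < r) (4 ∷ 12 ∷ 16 ∷ 20 ∷ 28 ∷ [])
good-residues =
  (quadruple (odd 0) , z<s) ∷ (quadruple (odd 1) , z<s) ∷ (quadruple (quadruple (odd 0)) , z<s) ∷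
  (quadruple (odd 2) , z<s) ∷ (quadruple (odd 3) , z<s) ∷ []
  where open Data.List.Relation.Unary.All using (_∷_; [])

bad-residues : All Bad (2 ∷ 6 ∷ 8 ∷ 10 ∷ 14 ∷ 18 ∷ 22 ∷ 24 ∷ 26 ∷ 30 ∷ [])
bad-residues =
  double (odd 0) ∷ double (odd 1) ∷ double (quadruple (odd 0)) ∷ double (odd 2) ∷ double (odd 3) ∷
  double (odd 4) ∷ double (odd 5) ∷ double (quadruple (odd 1)) ∷ double (odd 6) ∷ double (odd 7) ∷ []
  where open Data.List.Relation.Unary.All using (_∷_; [])

mainTheorem8 : (n : ℕ) → 3 ≤ n →
    ((n % 2 ≡ 1 → IsP (0 , 0 , n))
    × (n % 32 ∈ (4 ∷ 12 ∷ 16 ∷ 20 ∷ 28 ∷ []) → IsP (0 , 0 , n))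
    × (n % 32 ∈ (2 ∷ 6 ∷ 8 ∷ 10 ∷ 14 ∷ 18 ∷ 22 ∷ 24 ∷ 26 ∷ 30 ∷ []) → ¬ IsP (0 , 0 , n)))
mainTheorem8 n _ =
    (λ n%2≡1 → good⇒IsP (good-from-residue 1 n (subst (λ r → Good r × 0 < r) (sym n%2≡1) (odd 0 , z<s))))
  , (λ n%32∈ → good⇒IsP (good-from-residue 5 n (lookup good-residues n%32∈)))
  , (λ n%32∈ isP → isP (¬PPos⇒Win (bad⇒¬PPos (bad-from-residue 4 n (lookup bad-residues n%32∈)))))
  where
  good⇒IsP : Good n → IsP (0 , 0 , n)
  good⇒IsP g = PPos⇒IsP (pair₀₁ refl g)
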